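{- Let $\gamma$ be a proper $n$-edge coloring of a signed simple graph $\Sigma$ ($n$ odd, so $0\in M_n$), let $a\in M_n$ be nonzero with $a$ absent and $0$ present at a vertex $v_0$, and let $K_{a,0}(v_0,v_m)=(v_0,\ldots,v_m)$ be the $a/0$-chain at $v_0$. If the first repeated vertex of this trail is $v_s$, with $v_s=v_j$ for some $j<s$ (and no vertex among $v_0,\ldots,v_{s-1}$ repeated), then $s=m$, i.e. the chain terminates at its first self-intersection.
   Context: A signed graph is $\Sigma=(\Gamma,\sigma)$ with $\Gamma$ a finite simple graph and $\sigma:E(\Gamma)\to\{+,-\}$. An incidence is a pair $(v,e)$ with $v$ an endpoint of $e$. For $n\ge1$, $M_n=\{0,\pm1,\ldots,\pm k\}$ if $n=2k+1$ and $M_n=\{\pm1,\ldots,\pm k\}$ if $n=2k$. An $n$-edge coloring is a map $\gamma$ from incidences to $M_n$ with $\gamma(v,e)=-\sigma(e)\gamma(w,e)$ for each edge $e$ with endpoints $v,w$ (so both incidences of an edge have the same magnitude, called the magnitude of the edge); it is proper if $\gamma(v,e)\neq\gamma(v,f)$ for distinct edges $e,f$ at a common vertex $v$. A color $c$ is present at $v$ if $\gamma(v,e)=c$ for some edge $e$ at $v$, absent otherwise. A trail $(v_0,\ldots,v_m)$ is a sequence of vertices with consecutive ones adjacent and no edge repeated (vertices may repeat). For a trail, $t_i$ denotes the number of positive edges among $v_0v_1,\ldots,v_{i-1}v_i$. If $a$ is absent and $b$ present at $v_0$, the $a/b$-chain at $v_0$, written $K_{a,b}(v_0,v_m)$, is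 the maximal trail $(v_0,\ldots,v_m)$ starting at $v_0$ such that (1) the edge magnitudes alternate between $|b|$ and $|a|$ along it, starting with $|b|$, and (2) $\{\gamma(v_i,v_{i-1}v_i),\gamma(v_i,v_iv_{i+1})\}=\{(-1)^{t_i}a,(-1)^{t_i}b\}$ for all $0<i<m$. -}

module Defs where

open import Data.Nat as ℕ using (ℕ; zero; suc; _≤_; _<_; _/_; _%_)
open import Data.Integer as ℤ using (ℤ; ∣_∣; -_; _*_; -1ℤ; 0ℤ) renaming (_^_ to _^ℤ_)
open import Data.Fin using (Fin)
open import Data.Product using (Σ; ∃; _×_; ∃-syntax)
open import Data.Sum using (_⊎_)
open import Relation.Nullary using (¬_)
open import Relation.Binary.PropositionalEquality using (_≡_; _≢_)

data Sign : Set where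
  pos neg : Sign

-- A signed finite simple graph on the vertex set Fin N.
-- adj is a symmetric irreflexive adjacency relation; sign v w is the sign
-- of the edge vw (only meaningful when adj v w), symmetric in v, w.
record SignedGraph (N : ℕ) : Set₁ where
  field
    adj       : Fin N → Fin N → Set
    adj-sym   : ∀ {v w} → adj v w → adj w v
    adj-irrefl : ∀ {v} → ¬ adj v v
    sign      : Fin N → Fin N → Sign
    sign-sym  : ∀ {v w} → adj v w → sign v w ≡ sign w v
open SignedGraph public

-- The colour set M_n : for n = 2k+1, {0,±1,…,±k}; for n = 2k, {±1,…,±k}.
InM : ℕ → ℤ → Set
InM n c = (∣ c ∣ ≤ n / 2) × (n % 2 ≡ 0 → c ≢ 0ℤ)

signℤ : Sign → ℤ
signℤ pos = ℤ.+ 1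
signℤ neg = -1ℤ

-- An incidence colouring is γ : V → V → ℤ, where γ v w is the colour of
-- the incidence (v, vw) (only meaningful when v, w are adjacent).
record IsEdgeColoring {N : ℕ} (Σg : SignedGraph N) (n : ℕ) (γ : Fin N → Fin N → ℤ) : Set where
  field
    inM   : ∀ v w → adj Σg v w → InM n (γ v w)
    rule  : ∀ v w → adj Σg v w → γ v w ≡ - (signℤ (sign Σg v w) * γ w v)
open IsEdgeColoring public

IsProper : ∀ {N} (Σg : SignedGraph N) (γ : Fin N → Fin N → ℤ) → Set
IsProper {N} Σg γ = ∀ (v w w' : Fin N) → adj Σg v w → adj Σg v w' → w ≢ w' → γ v w ≢ γ v w'

IsProperColoring : ∀ {N} (Σg : SignedGraph N) (n : ℕ) (γ : Fin N → Fin N → ℤ) → Set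
IsProperColoring Σg n γ = IsEdgeColoring Σg n γ × IsProper Σg γ

Present : ∀ {N} (Σg : SignedGraph N) (γ : Fin N → Fin N → ℤ) → Fin N → ℤ → Set
Present Σg γ v c = ∃[ w ] (adj Σg v w × γ v w ≡ c)

Absent : ∀ {N} (Σg : SignedGraph N) (γ : Fin N → Fin N → ℤ) → Fin N → ℤ → Set
Absent Σg γ v c = ¬ Present Σg γ v c

-- A trail (v_0,…,v_m) is given by its length m and p : ℕ → V (only
-- p 0, …, p m matter).  Consecutive vertices adjacent, no edge repeated.
SameEdge : ∀ {N} (p : ℕ → Fin N) → ℕ → ℕ → Set
SameEdge p i j = (p i ≡ p j × p (suc i) ≡ p (suc j)) ⊎ (p i ≡ p (suc j) × p (suc i) ≡ p j)

IsTrail : ∀ {N} (Σg : SignedGraph N) (m : ℕ) (p : ℕ → Fin N) → Set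
IsTrail Σg m p =
  (∀ i → i < m → adj Σg (p i) (p (suc i))) ×
  (∀ i j → i < m → j < m → i ≢ j → ¬ SameEdge p i j)

posCount : ∀ {N} (Σg : SignedGraph N) (p : ℕ → Fin N) → ℕ → ℕ
posCount Σg p zero = zero
posCount Σg p (suc i) with sign Σg (p i) (p (suc i))
... | pos = suc (posCount Σg p i)
... | neg = posCount Σg p i

data Parity : Set where
  even odd : Parity

parity : ℕ → Parity
parity zero = even
parity (suc i) with parity i
... | even = odd
... | odd = even

reqMag : ℤ → ℤ → ℕ → ℕ
reqMag a b i with parity i
... | even = ∣ b ∣
... | odd = ∣ a ∣

IsABTrail : ∀ {N} (Σg : SignedGraph N) (γ : Fin N → Fin N → ℤ)
            (a b : ℤ) (v0 : Fin N) (m : ℕ) (p : ℕ → Fin N) → Set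
IsABTrail Σg γ a b v0 m p =
  p 0 ≡ v0 ×
  IsTrail Σg m p ×
  (∀ i → i < m → ∣ γ (p i) (p (suc i)) ∣ ≡ reqMag a b i) ×
  (∀ i → 0 < i → i < m →
     let s = -1ℤ ^ℤ posCount Σg p i
         x = γ (p i) (p (ℕ.pred i))
         y = γ (p i) (p (suc i))
     in (x ≡ s * a × y ≡ s * b) ⊎ (x ≡ s * b × y ≡ s * a))

-- The a/b-chain K_{a,b}(v0, v_m): a maximal such trail, i.e. no such trail
-- that extends it (agrees on v_0,…,v_m) is strictly longer.
IsChain : ∀ {N} (Σg : SignedGraph N) (γ : Fin N → Fin N → ℤ)
          (a b : ℤ) (v0 : Fin N) (m : ℕ) (p : ℕ → Fin N) → Set
IsChain {N} Σg γ a b v0 m p =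
  IsABTrail Σg γ a b v0 m p ×
  (∀ m' (p' : ℕ → Fin N) → IsABTrail Σg γ a b v0 m' p' →
     (∀ i → i ≤ m → p' i ≡ p i) → m' ≤ m)

module Submission where

-- Every edge of an a/0-chain has magnitude 0 or |a| and the chain alternates between them, so
-- each vertex v_i with i < m meets the chain in an edge coloured 0 at v_i (for v_0 its first
-- edge, for an inner vertex one of its two chain edges).  In a proper colouring a vertex has at
-- most one edge coloured 0, so if v_s = v_j with j < s < m, the two 0-coloured chain edges at this
-- vertex are the same edge of the graph; as a trail repeats no edge they have the same index,
-- which forces s = j + 1 and makes that edge a loop.  Hence v_0, …, v_{m-1} are distinct and the
-- first repetition can only be v_m.

open import Defs
open import Data.Nat using (ℕ; zero; suc; _≤_; _<_; _%_; z≤n; s≤s)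
open import Data.Nat.Properties using (n≮n; <-asym; n<1+n; ≤∧≮⇒≡)
import Data.Nat.Properties as ℕ
open import Data.Integer using (ℤ; 0ℤ; -1ℤ; _^_)
open import Data.Integer.Properties using (∣i∣≡0⇒i≡0; *-zeroʳ)
open import Data.Fin using (Fin)
import Data.Fin.Properties as Fin
open import Data.Product using (_,_; proj₁; proj₂)
open import Data.Sum using (inj₁; inj₂)
open import Relation.Nullary using (yes; no; contradiction)
open import Relation.Binary.PropositionalEquality using (_≡_; _≢_; refl; sym; trans; subst; cong)

proper⇒colour-injective : ∀ {N} {Σg : SignedGraph N} {γ : Fin N → Fin N → ℤ} → IsProper Σg γ →
  ∀ {v w w'} → adj Σg v w → adj Σg v w' → γ v w ≡ γ v w' → w ≡ w'
proper⇒colour-injective proper {v} {w} {w'} v~w v~w' same-colour with w Fin.≟ w'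
... | yes w≡w' = w≡w'
... | no w≢w' = contradiction same-colour (proper v w w' v~w v~w' w≢w')

-- EndOf k i o : position i is an end of the k-th edge (between positions k and k + 1) of a
-- trail, and o is its other end.
data EndOf : ℕ → ℕ → ℕ → Set where
  tail : ∀ k → EndOf k k (suc k)
  head : ∀ k → EndOf k (suc k) k

endOf-sameEdge : ∀ {N} (p : ℕ → Fin N) {k k' i i' o o'} →
  EndOf k i o → EndOf k' i' o' → p i ≡ p i' → p o ≡ p o' → SameEdge p k k'
endOf-sameEdge p (tail _) (tail _) pi≡pi' po≡po' = inj₁ (pi≡pi' , po≡po')
endOf-sameEdge p (tail _) (head _) pi≡pi' po≡po' = inj₂ (pi≡pi' , po≡po')
endOf-sameEdge p (head _) (tail _) pi≡pi' po≡po' = inj₂ (po≡po' , pi≡pi')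
endOf-sameEdge p (head _) (head _) pi≡pi' po≡po' = inj₁ (po≡po' , pi≡pi')

endOf-other≡upper : ∀ {k i i' o o'} → EndOf k i o → EndOf k i' o' → i' < i → o' ≡ i
endOf-other≡upper (tail k) (tail k) k<k = contradiction k<k (n≮n k)
endOf-other≡upper (tail k) (head k) 1+k<k = contradiction 1+k<k (<-asym (n<1+n k))
endOf-other≡upper (head k) (tail k) _ = refl
endOf-other≡upper (head k) (head k) 1+k<1+k = contradiction 1+k<1+k (n≮n (suc k))

module _ {N} {Σg : SignedGraph N} {m : ℕ} {p : ℕ → Fin N} (trail : IsTrail Σg m p) where

  trail-endOf-adj : ∀ {k i o} → k < m → EndOf k i o → adj Σg (p i) (p o)
  trail-endOf-adj k<m (tail k) = proj₁ trail k k<m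
  trail-endOf-adj k<m (head k) = adj-sym Σg (proj₁ trail k k<m)

  trail-sameEdge⇒≡ : ∀ {k k'} → k < m → k' < m → SameEdge p k k' → k ≡ k'
  trail-sameEdge⇒≡ {k} {k'} k<m k'<m same with k ℕ.≟ k'
  ... | yes k≡k' = k≡k'
  ... | no k≢k' = contradiction same (proj₂ trail k k' k<m k'<m k≢k')

record ZeroEdgeAt {N} (γ : Fin N → Fin N → ℤ) (m : ℕ) (p : ℕ → Fin N) (i : ℕ) : Set where
  constructor zeroEdge
  field
    {index other} : ℕ
    index<m : index < m
    endOf : EndOf index i other
    colour≡0 : γ (p i) (p other) ≡ 0ℤ

a0-trail-zeroEdgeAt : ∀ {N} {Σg : SignedGraph N} {γ : Fin N → Fin N → ℤ} {a : ℤ} {v0 : Fin N}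
  {m : ℕ} {p : ℕ → Fin N} → IsABTrail Σg γ a 0ℤ v0 m p → ∀ {i} → i < m → ZeroEdgeAt γ m p i
a0-trail-zeroEdgeAt (_ , _ , magnitude , _) {zero} 0<m =
  zeroEdge 0<m (tail 0) (∣i∣≡0⇒i≡0 (magnitude 0 0<m))
a0-trail-zeroEdgeAt {Σg = Σg} {p = p} (_ , _ , _ , alternation) {suc i} 1+i<m
  with alternation (suc i) (s≤s z≤n) 1+i<m
... | inj₁ (_ , forward≡s*0) =
  zeroEdge 1+i<m (tail (suc i)) (trans forward≡s*0 (*-zeroʳ (-1ℤ ^ posCount Σg p (suc i))))
... | inj₂ (backward≡s*0 , _) =
  zeroEdge (ℕ.<-trans (n<1+n i) 1+i<m) (head i)
    (trans backward≡s*0 (*-zeroʳ (-1ℤ ^ posCount Σg p (suc i))))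

a0-trail-injective-before-end : ∀ {N} {Σg : SignedGraph N} {γ : Fin N → Fin N → ℤ} → IsProper Σg γ →
  ∀ {a v0 m p} → IsABTrail Σg γ a 0ℤ v0 m p → ∀ {s j} → s < m → j < s → p s ≢ p j
a0-trail-injective-before-end {Σg = Σg} {γ} proper {p = p} a0-trail@(_ , trail , _) {s} {j}
  s<m j<s ps≡pj
  with a0-trail-zeroEdgeAt {Σg = Σg} {γ} a0-trail s<m
     | a0-trail-zeroEdgeAt {Σg = Σg} {γ} a0-trail (ℕ.<-trans j<s s<m)
... | zeroEdge {k} {o} k<m end-s γ-s≡0 | zeroEdge {k'} {o'} k'<m end-j γ-j≡0 =
  adj-irrefl Σg (subst (adj Σg (p s)) po≡ps ps~po)
  where
  ps~po : adj Σg (p s) (p o)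
  ps~po = trail-endOf-adj {Σg = Σg} trail k<m end-s

  ps~po' : adj Σg (p s) (p o')
  ps~po' = subst (λ v → adj Σg v (p o')) (sym ps≡pj)
    (trail-endOf-adj {Σg = Σg} trail k'<m end-j)

  po≡po' : p o ≡ p o'
  po≡po' = proper⇒colour-injective {Σg = Σg} {γ} proper ps~po ps~po'
    (trans γ-s≡0 (sym (subst (λ v → γ v (p o') ≡ 0ℤ) (sym ps≡pj) γ-j≡0)))

  k≡k' : k ≡ k'
  k≡k' = trail-sameEdge⇒≡ {Σg = Σg} trail k<m k'<m (endOf-sameEdge p end-s end-j ps≡pj po≡po')

  po≡ps : p o ≡ p s
  po≡ps = trans po≡po'
    (cong p (endOf-other≡upper end-s (subst (λ l → EndOf l j o') (sym k≡k') end-j) j<s))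

mainTheorem14 : ∀ {N : ℕ} (Σg : SignedGraph N) (n : ℕ) (γ : Fin N → Fin N → ℤ) →
    n % 2 ≡ 1 →
    IsProperColoring Σg n γ →
    ∀ (a : ℤ) (v0 : Fin N) → InM n a → a ≢ 0ℤ →
    Absent Σg γ v0 a → Present Σg γ v0 0ℤ →
    ∀ (m : ℕ) (p : ℕ → Fin N) → IsChain Σg γ a 0ℤ v0 m p →
    ∀ (s j : ℕ) → s ≤ m → j < s → p s ≡ p j →
    (∀ i i' → i < s → i' < s → p i ≡ p i' → i ≡ i') →
    s ≡ m
mainTheorem14 _ _ _ _ (_ , proper) _ _ _ _ _ _ _ _ (a0-trail , _) _ _ s≤m j<s ps≡pj _ =
  ≤∧≮⇒≡ s≤m (λ s<m → a0-trail-injective-before-end proper a0-trail s<m j<s ps≡pj)
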